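{- Let $q\ge1$ have a prime divisor congruent to $1\pmod 4$. Then there is no function $\psi:\mathbb{Z}_q\to\{ -1,+1\}$ that satisfies the functional equation $$\psi(x)\psi(y)\psi(z)=\psi\!\left(\frac{4xyz-x-y-z}{4(xy+yz+zx)-1}\right)\quad\text{for all }x,y,z\in\mathbb{Z}_q\text{ with }\gcd(4(xy+yz+zx)-1,q)=1$$ and is primitive.
   Context: $\mathbb{Z}_q=\mathbb{Z}/q\mathbb{Z}$; the quotient means multiplication by the inverse in $\mathbb{Z}_q$. A function $\psi:\mathbb{Z}_q\to\{ -1,+1\}$ (viewed as a $q$-periodic function on $\mathbb{Z}$) is called primitive if its smallest period is $q$. -}

module Defs where

open import Data.Nat as ℕ using (ℕ; suc; NonZero)
open import Data.Nat.GCD using (gcd)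
open import Data.Nat.Primality using (Prime)
open import Data.Nat.Divisibility using (_∣_)
open import Data.Integer as ℤ using (ℤ; +_)
import Data.Integer.Divisibility as ℤD
open import Data.Fin using (Fin; toℕ; fromℕ<)
open import Data.Nat.DivMod using (_%_; m%n<n)
open import Data.Sign using (Sign) renaming (_*_ to _*ₛ_)
open import Data.Product using (_×_; ∃-syntax)
open import Relation.Binary.PropositionalEquality using (_≡_)
open import Relation.Nullary using (¬_)

-- ℤ_q is represented by Fin q (residues 0..q-1); ±1 is represented by Sign (+ / -),
-- whose multiplication is the multiplication of ±1.

[_]_ : ℕ → (q : ℕ) → .{{NonZero q}} → Fin q
[ n ] q = fromℕ< (m%n<n n q)

_≡[mod_]_ : ℤ → ℕ → ℤ → Set
a ≡[mod q ] b = (+ q) ℤD.∣ (a ℤ.- b)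

⌜_⌝ : ∀ {q} → Fin q → ℤ
⌜ x ⌝ = + toℕ x

den : ℤ → ℤ → ℤ → ℤ
den x y z = + 4 ℤ.* (x ℤ.* y ℤ.+ y ℤ.* z ℤ.+ z ℤ.* x) ℤ.- + 1

num : ℤ → ℤ → ℤ → ℤ
num x y z = + 4 ℤ.* x ℤ.* y ℤ.* z ℤ.- x ℤ.- y ℤ.- z

-- ψ satisfies the functional equation: whenever gcd(4(xy+yz+zx)-1, q) = 1,
-- ψ(x)ψ(y)ψ(z) = ψ(w) where w = (4xyz-x-y-z)/(4(xy+yz+zx)-1) in ℤ_q,
-- i.e. w is the (unique) element of ℤ_q with w·den ≡ num (mod q).
SatisfiesFE : (q : ℕ) → (Fin q → Sign) → Set
SatisfiesFE q ψ = ∀ (x y z w : Fin q) →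
  gcd ℤ.∣ den ⌜ x ⌝ ⌜ y ⌝ ⌜ z ⌝ ∣ q ≡ 1 →
  (⌜ w ⌝ ℤ.* den ⌜ x ⌝ ⌜ y ⌝ ⌜ z ⌝) ≡[mod q ] num ⌜ x ⌝ ⌜ y ⌝ ⌜ z ⌝ →
  (ψ x *ₛ ψ y) *ₛ ψ z ≡ ψ w

-- d is a period of the q-periodic extension of ψ to ℕ (equivalently to ℤ)
IsPeriod : (q : ℕ) → .{{NonZero q}} → (Fin q → Sign) → ℕ → Set
IsPeriod q ψ d = ∀ (n : ℕ) → ψ ([ n ℕ.+ d ] q) ≡ ψ ([ n ] q)

Primitive : (q : ℕ) → .{{NonZero q}} → (Fin q → Sign) → Set
Primitive q ψ = ∀ (d : ℕ) → 0 ℕ.< d → d ℕ.< q → ¬ IsPeriod q ψ d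

-- Let p ≡ 1 (mod 4) be a prime dividing q and write q = p^(N+1) m with p ∤ m. Wilson's theorem
-- gives ((p-1)/2)!² ≡ -1 (mod p); Newton's iteration lifts this square root of -1 modulo
-- p^(N+1), and rescaling by the inverse of 2m yields c with m ∣ c and 4c² + 1 ≡ 0 (mod p^(N+1)),
-- so that q divides both c(4c² + 1) and m(4c² + 1). For such c the functional equation at
-- (c, y, 0) is solved by w = c + y(4c² + 1), which does not change under y ↦ y + m; cancelling
-- ψ(c)ψ(0) gives ψ(y) = ψ(y + jm) whenever p divides neither denominator 4cy - 1 nor
-- 4c(y + jm) - 1. As 4x² + 1 has only the roots ±c modulo p, from every n some point
-- z = n + (r+1)m with r < 3 is reachable in this way, with c or with -c, both from n and from
-- n + m. Hence m is a period of ψ, and m < q contradicts primitivity.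
module Submission where

open import Algebra.Bundles using (CommutativeMonoid)
open import Data.Empty using (⊥; ⊥-elim)
open import Data.Fin using (Fin; fromℕ<)
open import Data.Fin.Properties using (toℕ-fromℕ<; fromℕ<-cong)
open import Data.Integer as ℤ using (ℤ; +_; _+_; _*_; _-_; -_; ∣_∣; 0ℤ; 1ℤ; -1ℤ; _^_)
import Data.Integer.Properties as ℤ
open import Data.Integer.DivMod using (_%ℕ_; _/ℕ_; n%ℕd<d; a≡a%ℕn+[a/ℕn]*n)
open import Data.Integer.Divisibility.Signed
  using (∣-refl; ∣-trans; ∣m∣n⇒∣m+n; ∣n⇒∣m*n; ∣m⇒∣m*n; ∣m⇒∣-m; *-monoˡ-∣; *-monoʳ-∣; ∣⇒∣ᵤ; ∣ᵤ⇒∣; _∣?_)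
  renaming (_∣_ to _∣ℤ_)
open import Data.Integer.Tactic.RingSolver using (solve; solve-∀)
open import Data.List.Base using (List; []; _∷_; foldr; filter; length; applyDownFrom)
open import Data.List.Membership.Propositional using (_∈_)
open import Data.List.Membership.Propositional.Properties
  using (∈-filter⁺; ∈-filter⁻; ∈-applyDownFrom⁺; ∈-applyDownFrom⁻)
open import Data.List.Properties using (filter-all; filter-notAll)
open import Data.List.Relation.Unary.All as All using ()
open import Data.List.Relation.Unary.AllPairs as AllPairs using (_∷_)
open import Data.List.Relation.Unary.Any as Any using (here; there)
open import Data.List.Relation.Unary.Unique.Propositional using (Unique)
open import Data.List.Relation.Unary.Unique.Propositional.Properties
  using (filter⁺; applyDownFrom⁺₁; Unique[x∷xs]⇒x∉xs)
open import Data.Nat as ℕ using (ℕ; zero; suc; NonZero; z≤n; s≤s; _!; _%_; _/_)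
import Data.Nat.Properties as ℕ
open import Data.Nat.Coprimality using (Coprime; coprime-divisor; coprime-Bézout; coprime⇒gcd≡1)
open import Data.Nat.DivMod using (m≡m%n+[m/n]*n)
open import Data.Nat.Divisibility as ℕ using (_∣_; _∤_)
import Data.Nat.GCD as GCD
open import Data.Nat.Induction using (<-wellFounded)
open import Data.Nat.Primality
  using (Prime; euclidsLemma; prime⇒irreducible; prime⇒nonTrivial; irreducible[2])
open import Data.Nat.Tactic.RingSolver using () renaming (solve-∀ to ℕsolve-∀)
open import Data.Product using (_×_; _,_; ∃-syntax; proj₁; proj₂)
open import Data.Sign using (Sign) renaming (_*_ to _*ₛ_)
open import Data.Sign.Properties using (*-cancelˡ-≡; *-cancelʳ-≡)
open import Data.Sum using (_⊎_; inj₁; inj₂; [_,_]′)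
open import Function using (_∘_)
open import Induction.WellFounded using (Acc; acc)
open import Level using (0ℓ; _⊔_)
open import Relation.Binary.Definitions using (DecidableEquality)
open import Relation.Binary.PropositionalEquality hiding ([_])
open import Relation.Nullary using (¬_; Dec; yes; no)
open import Relation.Nullary.Decidable using (¬?)

open import Defs

∣-multiple : ∀ {n u} a {w} → n ∣ℤ u → w ≡ a * u → n ∣ℤ w
∣-multiple a n∣u refl = ∣n⇒∣m*n a n∣u

∣-combination : ∀ {n u v} a b {w} → n ∣ℤ u → n ∣ℤ v → w ≡ a * u + b * v → n ∣ℤ w
∣-combination a b n∣u n∣v refl = ∣m∣n⇒∣m+n (∣n⇒∣m*n a n∣u) (∣n⇒∣m*n b n∣v)

*-pres-∣ : ∀ {i a j b} → i ∣ℤ a → j ∣ℤ b → i * j ∣ℤ a * b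
*-pres-∣ {a = a} {j} i∣a j∣b = ∣-trans (*-monoˡ-∣ j i∣a) (*-monoʳ-∣ a j∣b)

p^suc∣⇒p∣ : ∀ {p z} n → + (p ℕ.^ suc n) ∣ℤ z → + p ∣ℤ z
p^suc∣⇒p∣ {p} n = ∣-trans (∣ᵤ⇒∣ {+ p} {+ (p ℕ.^ suc n)} (ℕ.m∣m*n (p ℕ.^ n)))

∣-%ℕ : ∀ u n .{{_ : NonZero n}} → + n ∣ℤ + (u %ℕ n) - u
∣-%ℕ u n = ∣-multiple (- (u /ℕ n)) ∣-refl (identity (+ (u %ℕ n)) (u /ℕ n) (+ n) u (a≡a%ℕn+[a/ℕn]*n u n))
  where
  identity : ∀ r t m u → u ≡ r + t * m → r - u ≡ - t * m
  identity r t m u refl = solve (r ∷ t ∷ m ∷ [])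

∣-<-difference⇒≡ : ∀ {n a b} → a ℕ.< n → b ℕ.< n → + n ∣ℤ + a - + b → a ≡ b
∣-<-difference⇒≡ {n} {a} {b} a<n b<n n∣a-b =
  ℤ.+-injective (ℤ.i-j≡0⇒i≡j (+ a) (+ b) (ℤ.∣i∣≡0⇒i≡0 ∣a-b∣≡0))
  where
  ∣a-b∣<n : ∣ + a - + b ∣ ℕ.< n
  ∣a-b∣<n rewrite ℤ.m-n≡m⊖n a b = ℕ.≤-<-trans (ℤ.∣m⊝n∣≤m⊔n a b) (ℕ.⊔-lub a<n b<n)
  ∣a-b∣≡0 : ∣ + a - + b ∣ ≡ 0
  ∣a-b∣≡0 with ∣ + a - + b ∣ | ∣a-b∣<n | ∣⇒∣ᵤ n∣a-b
  ... | zero  | _   | _   = refl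
  ... | suc d | d<n | n∣d = ⊥-elim (ℕ.>⇒∤ d<n n∣d)

pos-1+*≡* : ∀ i j k l → 1 ℕ.+ i ℕ.* j ≡ k ℕ.* l → 1ℤ + + i * + j ≡ + k * + l
pos-1+*≡* i j k l eq = begin
  1ℤ + + i * + j      ≡⟨ cong (λ t → 1ℤ + t) (ℤ.pos-* i j) ⟨
  1ℤ + + (i ℕ.* j)    ≡⟨ ℤ.pos-+ 1 (i ℕ.* j) ⟨
  + (1 ℕ.+ i ℕ.* j)   ≡⟨ cong +_ eq ⟩
  + (k ℕ.* l)         ≡⟨ ℤ.pos-* k l ⟩
  + k * + l           ∎
  where open ≡-Reasoning

pos-suc-* : ∀ m n → + (suc m ℕ.* n) ≡ (1ℤ + + m) * + n
pos-suc-* m n = trans (ℤ.pos-* (suc m) n) (cong (_* + n) (ℤ.pos-+ 1 m))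

pos-+-* : ∀ n k m → + (n ℕ.+ k ℕ.* m) ≡ + n + + k * + m
pos-+-* n k m = trans (ℤ.pos-+ n (k ℕ.* m)) (cong (λ t → + n + t) (ℤ.pos-* k m))

coprime-*ʳ : ∀ {a m n} → Coprime a m → Coprime a n → Coprime a (m ℕ.* n)
coprime-*ʳ {a} {m} a⊥m a⊥n {d} (d∣a , d∣mn) = a⊥n (d∣a , coprime-divisor d⊥m d∣mn)
  where
  d⊥m : Coprime d m
  d⊥m (e∣d , e∣m) = a⊥m (ℕ.∣-trans e∣d d∣a , e∣m)

∣-suc⇒coprime : ∀ a {m} → + m ∣ℤ a + 1ℤ → Coprime ∣ a ∣ m
∣-suc⇒coprime a {m} m∣a+1 {i} (i∣a , i∣m) = ℕ.∣1⇒≡1 (∣⇒∣ᵤ i∣1)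
  where
  identity : ∀ a → 1ℤ ≡ 1ℤ * (a + 1ℤ) + -1ℤ * a
  identity = solve-∀
  i∣1 : + i ∣ℤ 1ℤ
  i∣1 = ∣-combination 1ℤ -1ℤ (∣-trans (∣ᵤ⇒∣ {+ i} {+ m} i∣m) m∣a+1) (∣ᵤ⇒∣ {+ i} {a} i∣a) (identity a)

coprime-resp-mod : ∀ {q} a b → + q ∣ℤ a - b → Coprime ∣ b ∣ q → Coprime ∣ a ∣ q
coprime-resp-mod {q} a b q∣a-b b⊥q {i} (i∣a , i∣q) = b⊥q (∣⇒∣ᵤ i∣b , i∣q)
  where
  identity : ∀ a b → b ≡ 1ℤ * a + -1ℤ * (a - b)
  identity = solve-∀
  i∣b : + i ∣ℤ b
  i∣b = ∣-combination 1ℤ -1ℤ (∣ᵤ⇒∣ {+ i} {a} i∣a) (∣-trans (∣ᵤ⇒∣ {+ i} {+ q} i∣q) q∣a-b) (identity a b)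

coprime⇒inverse : ∀ {a n} → Coprime a n → ∃[ u ] + n ∣ℤ + a * u - 1ℤ
coprime⇒inverse {a} {n} a⊥n with coprime-Bézout a⊥n
... | GCD.Bézout.+- x y 1+yn≡xa =
  + x , ∣-multiple (+ y) ∣-refl (+-case (+ a) (+ x) (+ y) (+ n) (pos-1+*≡* y n x a 1+yn≡xa))
  where
  +-case : ∀ A X Y N → 1ℤ + Y * N ≡ X * A → A * X - 1ℤ ≡ Y * N
  +-case A X Y N eq = begin
    A * X - 1ℤ          ≡⟨ cong (_- 1ℤ) (ℤ.*-comm A X) ⟩
    X * A - 1ℤ          ≡⟨ cong (_- 1ℤ) eq ⟨
    1ℤ + Y * N - 1ℤ     ≡⟨ solve (Y ∷ N ∷ []) ⟩
    Y * N               ∎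
    where open ≡-Reasoning
... | GCD.Bézout.-+ x y 1+xa≡yn =
  - + x , ∣-multiple (- + y) ∣-refl (-+-case (+ a) (+ x) (+ y) (+ n) (pos-1+*≡* x a y n 1+xa≡yn))
  where
  -+-case : ∀ A X Y N → 1ℤ + X * A ≡ Y * N → A * - X - 1ℤ ≡ - Y * N
  -+-case A X Y N eq = begin
    A * - X - 1ℤ        ≡⟨ solve (A ∷ X ∷ []) ⟩
    - (1ℤ + X * A)      ≡⟨ cong -_ eq ⟩
    - (Y * N)           ≡⟨ ℤ.neg-distribˡ-* Y N ⟩
    - Y * N             ∎
    where open ≡-Reasoning

module _ {p : ℕ} (p-prime : Prime p) where

  prime∤1 : ¬ + p ∣ℤ 1ℤ
  prime∤1 p∣1 = ℕ.nonTrivial⇒≢1 {{prime⇒nonTrivial p-prime}} (ℕ.∣1⇒≡1 (∣⇒∣ᵤ p∣1))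

  prime∣*⇒∣⊎∣ : ∀ x y → + p ∣ℤ x * y → + p ∣ℤ x ⊎ + p ∣ℤ y
  prime∣*⇒∣⊎∣ x y p∣xy
    with euclidsLemma ∣ x ∣ ∣ y ∣ p-prime (subst (p ∣_) (ℤ.abs-* x y) (∣⇒∣ᵤ p∣xy))
  ... | inj₁ p∣x = inj₁ (∣ᵤ⇒∣ p∣x)
  ... | inj₂ p∣y = inj₂ (∣ᵤ⇒∣ p∣y)

  prime∤⇒coprime : ∀ {n} → p ∤ n → Coprime n p
  prime∤⇒coprime p∤n (d∣n , d∣p) with prime⇒irreducible p-prime d∣p
  ... | inj₁ d≡1  = d≡1
  ... | inj₂ refl = ⊥-elim (p∤n d∣n)

  prime∤⇒coprime-^ : ∀ {n} k → p ∤ n → Coprime n (p ℕ.^ k)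
  prime∤⇒coprime-^ zero    _   (_ , d∣1) = ℕ.∣1⇒≡1 d∣1
  prime∤⇒coprime-^ (suc k) p∤n = coprime-*ʳ (prime∤⇒coprime p∤n) (prime∤⇒coprime-^ k p∤n)

  prime∤⇒inverse : ∀ {a} → ¬ + p ∣ℤ a → ∃[ u ] + p ∣ℤ a * u - 1ℤ
  prime∤⇒inverse {a} p∤a with coprime⇒inverse (prime∤⇒coprime (p∤a ∘ ∣ᵤ⇒∣)) | ℤ.+∣i∣≡i⊎+∣i∣≡-i a
  ... | u , p∣∣a∣u-1 | inj₁ ∣a∣≡a  = u , subst (λ t → + p ∣ℤ t * u - 1ℤ) ∣a∣≡a p∣∣a∣u-1
  ... | u , p∣∣a∣u-1 | inj₂ ∣a∣≡-a = - u , subst (λ t → + p ∣ℤ t - 1ℤ) ∣a∣u≡a*-u p∣∣a∣u-1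
    where
    ∣a∣u≡a*-u : + ∣ a ∣ * u ≡ a * - u
    ∣a∣u≡a*-u = trans (cong (_* u) ∣a∣≡-a) (trans (sym (ℤ.neg-distribˡ-* a u)) (ℤ.neg-distribʳ-* a u))

-- Products paired off by inverses

module Pairing {c ℓ a} (M : CommutativeMonoid c ℓ) {A : Set a} (_≟_ : DecidableEquality A)
               (f : A → CommutativeMonoid.Carrier M) where

  open CommutativeMonoid M
    using (Carrier; _≈_; _∙_; ε; assoc; comm; identityˡ; identityʳ; ∙-congˡ; ∙-congʳ; reflexive;
           commutativeSemigroup)
    renaming (setoid to ≈-setoid; refl to ≈-refl; trans to ≈-trans)
  open import Algebra.Properties.CommutativeSemigroup commutativeSemigroup using (x∙yz≈y∙xz)
  open import Relation.Binary.Reasoning.Setoid ≈-setoid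

  ∏ : List A → Carrier
  ∏ = foldr (λ x r → f x ∙ r) ε

  _∖_ : List A → A → List A
  xs ∖ x = filter (λ y → ¬? (y ≟ x)) xs

  InjectiveOn : List A → Set (a ⊔ ℓ)
  InjectiveOn xs = ∀ {x y} → x ∈ xs → y ∈ xs → f x ≈ f y → x ≡ y

  Paired : List A → Set (a ⊔ ℓ)
  Paired xs = ∀ {x} → x ∈ xs → ∃[ y ] (y ∈ xs × y ≢ x × f x ∙ f y ≈ ε)

  inverse-unique : ∀ {x y z} → x ∙ y ≈ ε → x ∙ z ≈ ε → y ≈ z
  inverse-unique {x} {y} {z} xy≈ε xz≈ε = begin
    y              ≈⟨ identityʳ y ⟨
    y ∙ ε          ≈⟨ ∙-congˡ xz≈ε ⟨
    y ∙ (x ∙ z)    ≈⟨ assoc y x z ⟨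
    (y ∙ x) ∙ z    ≈⟨ ∙-congʳ (≈-trans (comm y x) xy≈ε) ⟩
    ε ∙ z          ≈⟨ identityˡ z ⟩
    z              ∎

  ∏-∖ : ∀ {x xs} → Unique xs → x ∈ xs → ∏ xs ≈ f x ∙ ∏ (xs ∖ x)
  ∏-∖ {x} {y ∷ ys} (y∉ys ∷ _) _ with y ≟ x
  ... | yes refl = ∙-congˡ (reflexive (cong ∏ (sym (filter-all _ (All.map (_∘ sym) y∉ys)))))
  ∏-∖ {x} {y ∷ ys} _          (here x≡y)   | no y≢x = ⊥-elim (y≢x (sym x≡y))
  ∏-∖ {x} {y ∷ ys} (_ ∷ uniq) (there x∈ys) | no _   = begin
    f y ∙ ∏ ys                   ≈⟨ ∙-congˡ (∏-∖ uniq x∈ys) ⟩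
    f y ∙ (f x ∙ ∏ (ys ∖ x))     ≈⟨ x∙yz≈y∙xz (f y) (f x) _ ⟩
    f x ∙ (f y ∙ ∏ (ys ∖ x))     ∎

  Paired-∖ : ∀ {x y xs} → Unique (x ∷ xs) → InjectiveOn (x ∷ xs) → Paired (x ∷ xs) →
             y ∈ xs → f x ∙ f y ≈ ε → Paired (xs ∖ y)
  Paired-∖ {x} {y} {xs} uniq inj paired y∈xs xy≈ε z∈xs∖y
    with z∈xs , z≢y ← ∈-filter⁻ (λ v → ¬? (v ≟ y)) z∈xs∖y
    with paired (there z∈xs)
  ... | _ , here refl , _ , zx≈ε =
    ⊥-elim (z≢y (inj (there z∈xs) (there y∈xs)
                     (inverse-unique (≈-trans (comm (f x) (f _)) zx≈ε) xy≈ε)))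
  ... | w , there w∈xs , w≢z , zw≈ε with w ≟ y
  ...   | yes refl = ⊥-elim (Unique[x∷xs]⇒x∉xs uniq (subst (_∈ xs) z≡x z∈xs))
    where
    z≡x = inj (there z∈xs) (here refl)
            (inverse-unique (≈-trans (comm (f y) (f _)) zw≈ε) (≈-trans (comm (f y) (f x)) xy≈ε))
  ...   | no w≢y = w , ∈-filter⁺ (λ v → ¬? (v ≟ y)) w∈xs w≢y , w≢z , zw≈ε

  ∏-paired≈ε : ∀ xs → Unique xs → InjectiveOn xs → Paired xs → ∏ xs ≈ ε
  ∏-paired≈ε xs = go xs (<-wellFounded _)
    where
    go : ∀ xs → Acc ℕ._<_ (length xs) → Unique xs → InjectiveOn xs → Paired xs → ∏ xs ≈ ε
    go []       _         _    _   _      = ≈-refl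
    go (x ∷ xs) (acc rec) uniq inj paired with paired (here refl)
    ... | y , here refl , y≢x , _ = ⊥-elim (y≢x refl)
    ... | y , there y∈xs , _ , xy≈ε = begin
      f x ∙ ∏ xs                 ≈⟨ ∙-congˡ (∏-∖ (AllPairs.tail uniq) y∈xs) ⟩
      f x ∙ (f y ∙ ∏ (xs ∖ y))   ≈⟨ assoc (f x) (f y) _ ⟨
      (f x ∙ f y) ∙ ∏ (xs ∖ y)   ≈⟨ ∙-congʳ xy≈ε ⟩
      ε ∙ ∏ (xs ∖ y)             ≈⟨ identityˡ _ ⟩
      ∏ (xs ∖ y)                 ≈⟨ go (xs ∖ y) (rec shorter) (filter⁺ _ (AllPairs.tail uniq))
                                      (λ u v → inj (there (proj₁ (∈-filter⁻ _ u)))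
                                                   (there (proj₁ (∈-filter⁻ _ v))))
                                      (Paired-∖ uniq inj paired y∈xs xy≈ε) ⟩
      ε                          ∎
      where
      shorter = ℕ.<-trans (filter-notAll _ xs (Any.map (λ y≡v v≢y → v≢y (sym y≡v)) y∈xs)) (ℕ.n<1+n _)

-- Wilson's theorem and a square root of -1

*-commutativeMonoid-mod : ℕ → CommutativeMonoid 0ℓ 0ℓ
*-commutativeMonoid-mod n = record
  { Carrier = ℤ
  ; _≈_ = λ a b → + n ∣ℤ a - b
  ; _∙_ = _*_
  ; ε = 1ℤ
  ; isCommutativeMonoid = record
    { isMonoid = record
      { isSemigroup = record
        { isMagma = record
          { isEquivalence = record
            { refl = λ {a} → ≡⇒≈ {a} refl
            ; sym = λ {a} {b} a≈b → ∣-multiple -1ℤ a≈b (solve (a ∷ b ∷ []))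
            ; trans = λ {a} {b} {c} a≈b b≈c → ∣-combination 1ℤ 1ℤ a≈b b≈c (solve (a ∷ b ∷ c ∷ []))
            }
          ; ∙-cong = λ {a} {b} {c} {d} a≈b c≈d → ∣-combination c b a≈b c≈d (solve (a ∷ b ∷ c ∷ d ∷ []))
          }
        ; assoc = λ a b c → ≡⇒≈ (ℤ.*-assoc a b c)
        }
      ; identity = (λ a → ≡⇒≈ (ℤ.*-identityˡ a)) , (λ a → ≡⇒≈ (ℤ.*-identityʳ a))
      }
    ; comm = λ a b → ≡⇒≈ (ℤ.*-comm a b)
    }
  }
  where
  ≡⇒≈ : ∀ {a b} → a ≡ b → + n ∣ℤ a - b
  ≡⇒≈ {a} refl = ∣-multiple 0ℤ ∣-refl (trans (ℤ.+-inverseʳ a) (sym (ℤ.*-zeroˡ (+ n))))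

module _ {n : ℕ} (p-prime : Prime (3 ℕ.+ n)) where

  private
    p = 3 ℕ.+ n
    open Pairing (*-commutativeMonoid-mod p) ℕ._≟_ +_

    L : List ℕ
    L = applyDownFrom (2 ℕ.+_) n

    ∈L⁺ : ∀ {v} → 2 ℕ.≤ v → v ℕ.< 2 ℕ.+ n → v ∈ L
    ∈L⁺ {suc (suc i)} (s≤s (s≤s z≤n)) (s≤s (s≤s i<n)) = ∈-applyDownFrom⁺ (2 ℕ.+_) i<n

    ∈L⁻ : ∀ {v} → v ∈ L → 2 ℕ.≤ v × v ℕ.< 2 ℕ.+ n
    ∈L⁻ v∈L with i , i<n , refl ← ∈-applyDownFrom⁻ (2 ℕ.+_) v∈L = s≤s (s≤s z≤n) , s≤s (s≤s i<n)

    ∈L⇒<p : ∀ {v} → v ∈ L → v ℕ.< p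
    ∈L⇒<p v∈L = ℕ.<-trans (proj₂ (∈L⁻ v∈L)) (ℕ.n<1+n _)

    ∏-applyDownFrom : ∀ k → ∏ (applyDownFrom (2 ℕ.+_) k) ≡ + (suc k !)
    ∏-applyDownFrom zero    = refl
    ∏-applyDownFrom (suc k) =
      trans (cong (+ (2 ℕ.+ k) *_) (∏-applyDownFrom k)) (sym (ℤ.pos-* (2 ℕ.+ k) (suc k !)))

    L-unique : Unique L
    L-unique = applyDownFrom⁺₁ (2 ℕ.+_) n (λ j<i _ eq → ℕ.<⇒≢ j<i (sym (ℕ.+-cancelˡ-≡ 2 _ _ eq)))

    L-injective : InjectiveOn L
    L-injective u∈L v∈L = ∣-<-difference⇒≡ (∈L⇒<p u∈L) (∈L⇒<p v∈L)

    p∤v-1 : ∀ {v} → v ∈ L → ¬ + p ∣ℤ + v - 1ℤ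
    p∤v-1 v∈L p∣v-1 with ∣-<-difference⇒≡ (∈L⇒<p v∈L) (s≤s (s≤s z≤n)) p∣v-1 | proj₁ (∈L⁻ v∈L)
    ... | refl | s≤s ()

    p∤v+1 : ∀ {v} → v ∈ L → ¬ + p ∣ℤ + v + 1ℤ
    p∤v+1 {v} v∈L p∣v+1 with () ← ∣-<-difference⇒≡ (s≤s (proj₂ (∈L⁻ v∈L))) (s≤s z≤n)
      (subst (+ p ∣ℤ_) (cong +_ (trans (ℕ.+-comm v 1) (sym (ℕ.+-identityʳ (suc v))))) p∣v+1)

    inverse∈L : ∀ {v w} → v ∈ L → w ℕ.< p → + p ∣ℤ + v * + w - 1ℤ → w ∈ L
    inverse∈L {v} {zero} v∈L _ p∣v0-1 =
      ⊥-elim (prime∤1 p-prime (∣-multiple -1ℤ p∣v0-1 (identity (+ v))))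
      where
      identity : ∀ V → 1ℤ ≡ -1ℤ * (V * 0ℤ - 1ℤ)
      identity V = solve (V ∷ [])
    inverse∈L {v} {1} v∈L _ p∣v1-1 =
      ⊥-elim (p∤v-1 v∈L (subst (λ t → + p ∣ℤ t - 1ℤ) (ℤ.*-identityʳ (+ v)) p∣v1-1))
    inverse∈L {v} {w@(suc (suc _))} v∈L w<p p∣vw-1 =
      ∈L⁺ (s≤s (s≤s z≤n)) (ℕ.≤∧≢⇒< (ℕ.≤-pred w<p) w≢p-1)
      where
      w≢p-1 : w ≢ 2 ℕ.+ n
      w≢p-1 refl = p∤v+1 v∈L (∣-combination -1ℤ (+ v) p∣vw-1 ∣-refl (identity (+ v) (+ (2 ℕ.+ n))))
        where
        identity : ∀ V T → V + 1ℤ ≡ -1ℤ * (V * T - 1ℤ) + V * (1ℤ + T)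
        identity V T = solve (V ∷ T ∷ [])

    ∈L⇒p∤ : ∀ {v} → v ∈ L → ¬ + p ∣ℤ + v
    ∈L⇒p∤ v∈L p∣v =
      ℕ.>⇒∤ {{ℕ.>-nonZero (ℕ.<-trans (s≤s z≤n) (proj₁ (∈L⁻ v∈L)))}} (∈L⇒<p v∈L) (∣⇒∣ᵤ p∣v)

    residue-partner : ∀ {v u} → v ∈ L → + p ∣ℤ + v * u - 1ℤ →
                      ∃[ w ] (w ∈ L × w ≢ v × + p ∣ℤ + v * + w - 1ℤ)
    residue-partner {v} {u} v∈L p∣vu-1 = w , inverse∈L v∈L (n%ℕd<d u p) p∣vw-1 , w≢v , p∣vw-1
      where
      w = u %ℕ p
      p∣vw-1 : + p ∣ℤ + v * + w - 1ℤ
      p∣vw-1 = ∣-combination 1ℤ (+ v) p∣vu-1 (∣-%ℕ u p) (identity (+ v) (+ w) u)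
        where
        identity : ∀ V W U → V * W - 1ℤ ≡ 1ℤ * (V * U - 1ℤ) + V * (W - U)
        identity V W U = solve (V ∷ W ∷ U ∷ [])
      w≢v : w ≢ v
      w≢v w≡v with prime∣*⇒∣⊎∣ p-prime (+ v - 1ℤ) (+ v + 1ℤ) (∣-multiple 1ℤ p∣vv-1 (identity (+ v)))
        where
        p∣vv-1 = subst (λ t → + p ∣ℤ + v * + t - 1ℤ) w≡v p∣vw-1
        identity : ∀ V → (V - 1ℤ) * (V + 1ℤ) ≡ 1ℤ * (V * V - 1ℤ)
        identity V = solve (V ∷ [])
      ... | inj₁ p∣v-1 = p∤v-1 v∈L p∣v-1
      ... | inj₂ p∣v+1 = p∤v+1 v∈L p∣v+1

    L-paired : Paired L
    L-paired v∈L with _ , p∣vu-1 ← prime∤⇒inverse p-prime (∈L⇒p∤ v∈L) = residue-partner v∈L p∣vu-1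

  wilson-3+ : + p ∣ℤ + ((2 ℕ.+ n) !) + 1ℤ
  wilson-3+ = ∣-combination T 1ℤ p∣∏L-1 ∣-refl
    (identity (ℤ.pos-* (2 ℕ.+ n) (suc n !)) (ℤ.pos-+ 1 (2 ℕ.+ n)))
    where
    T = + (2 ℕ.+ n)
    X = + (suc n !)
    p∣∏L-1 : + p ∣ℤ X - 1ℤ
    p∣∏L-1 = subst (λ t → + p ∣ℤ t - 1ℤ) (∏-applyDownFrom n) (∏-paired≈ε L L-unique L-injective L-paired)
    polynomial-identity : ∀ T X → T * X + 1ℤ ≡ T * (X - 1ℤ) + 1ℤ * (1ℤ + T)
    polynomial-identity = solve-∀
    identity : ∀ {F P} → F ≡ T * X → P ≡ 1ℤ + T → F + 1ℤ ≡ T * (X - 1ℤ) + 1ℤ * P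
    identity refl refl = polynomial-identity T X

wilson : ∀ {n} → Prime (suc n) → + suc n ∣ℤ + (n !) + 1ℤ
wilson {zero}        p-prime = ⊥-elim (ℕ.nonTrivial⇒≢1 {{prime⇒nonTrivial p-prime}} refl)
wilson {suc zero}    _       = ∣-refl
wilson {suc (suc n)} p-prime = wilson-3+ p-prime

-- a + i ≡ -(b + 1 - i) modulo a + b + 1, so the factors a + 1, …, a + b of (a + b)! reflect to b!.
factorial-reflection : ∀ a b → + suc (a ℕ.+ b) ∣ℤ + ((a ℕ.+ b) !) - -1ℤ ^ b * (+ (a !) * + (b !))
factorial-reflection a zero rewrite ℕ.+-identityʳ a = ∣-multiple 0ℤ ∣-refl (identity (+ (a !)) (+ suc a))
  where
  identity : ∀ A M → A - 1ℤ * (A * 1ℤ) ≡ 0ℤ * M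
  identity = solve-∀
factorial-reflection a (suc b) rewrite ℕ.+-suc a b =
  ∣-combination 1ℤ (S * A * B) (factorial-reflection (suc a) b) ∣-refl
    (identity (pos-suc-* b (b !)) (pos-suc-* a (a !)) modulus)
  where
  S = -1ℤ ^ b
  A = + (a !)
  B = + (b !)
  X = + (suc (a ℕ.+ b) !)
  modulus : + suc (suc (a ℕ.+ b)) ≡ 1ℤ + (1ℤ + (+ a + + b))
  modulus = trans (ℤ.pos-+ 1 _)
    (cong (λ t → 1ℤ + t) (trans (ℤ.pos-+ 1 _) (cong (λ t → 1ℤ + t) (ℤ.pos-+ a b))))
  polynomial-identity : ∀ X S A B a b → X - -1ℤ * S * (A * ((1ℤ + b) * B))
                        ≡ 1ℤ * (X - S * ((1ℤ + a) * A * B)) + S * A * B * (1ℤ + (1ℤ + (a + b)))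
  polynomial-identity = solve-∀
  identity : ∀ {B′ A′ M} → B′ ≡ (1ℤ + + b) * B → A′ ≡ (1ℤ + + a) * A → M ≡ 1ℤ + (1ℤ + (+ a + + b)) →
         X - -1ℤ * S * (A * B′) ≡ 1ℤ * (X - S * (A′ * B)) + S * A * B * M
  identity refl refl refl = polynomial-identity X S A B (+ a) (+ b)

-1^[k+k]≡1 : ∀ k → -1ℤ ^ (k ℕ.+ k) ≡ 1ℤ
-1^[k+k]≡1 zero = refl
-1^[k+k]≡1 (suc k) rewrite ℕ.+-suc k k | -1^[k+k]≡1 k = refl

prime≡1mod4⇒√-1 : ∀ {p} → Prime p → p % 4 ≡ 1 → ∃[ x ] + p ∣ℤ x * x + 1ℤ
prime≡1mod4⇒√-1 {p} p-prime p%4≡1 = X , subst (λ m → + m ∣ℤ X * X + 1ℤ) (sym p≡1+h+h)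
  (∣-combination 1ℤ -1ℤ (wilson (subst Prime p≡1+h+h p-prime)) (factorial-reflection h h)
    (identity (-1^[k+k]≡1 k)))
  where
  k = p / 4
  h = k ℕ.+ k
  X = + (h !)
  W = + ((h ℕ.+ h) !)
  k*4≡h+h : ∀ k → k ℕ.* 4 ≡ (k ℕ.+ k) ℕ.+ (k ℕ.+ k)
  k*4≡h+h = ℕsolve-∀
  p≡1+h+h : p ≡ suc (h ℕ.+ h)
  p≡1+h+h = trans (m≡m%n+[m/n]*n p 4) (cong₂ ℕ._+_ p%4≡1 (k*4≡h+h k))
  identity : ∀ {S} → S ≡ 1ℤ → X * X + 1ℤ ≡ 1ℤ * (W + 1ℤ) + -1ℤ * (W - S * (X * X))
  identity refl = polynomial-identity X W
    where
    polynomial-identity : ∀ X W → X * X + 1ℤ ≡ 1ℤ * (W + 1ℤ) + -1ℤ * (W - 1ℤ * (X * X))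
    polynomial-identity = solve-∀

-- Lifting the square root of -1

4x²+1 : ℤ → ℤ
4x²+1 x = + 4 * x * x + 1ℤ

module OddPrime {p : ℕ} (p-prime : Prime p) (p∤2 : p ∤ 2) where

  ∣2*⇒∣ : ∀ {x} → + p ∣ℤ + 2 * x → + p ∣ℤ x
  ∣2*⇒∣ {x} p∣2x with prime∣*⇒∣⊎∣ p-prime (+ 2) x p∣2x
  ... | inj₁ p∣2 = ⊥-elim (p∤2 (∣⇒∣ᵤ p∣2))
  ... | inj₂ p∣x = p∣x

  p∤2* : ∀ {m} → p ∤ m → p ∤ 2 ℕ.* m
  p∤2* {m} p∤m p∣2m = [ p∤2 , p∤m ]′ (euclidsLemma 2 m p-prime p∣2m)

  √-1-lift : ∀ {x} → + p ∣ℤ x * x + 1ℤ → ∀ n → ∃[ y ] + (p ℕ.^ suc n) ∣ℤ y * y + 1ℤ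
  √-1-lift {x} p∣x²+1 zero = x , subst (λ m → + m ∣ℤ x * x + 1ℤ) (sym (ℕ.*-identityʳ p)) p∣x²+1
  √-1-lift {x} p∣x²+1 (suc n) with y , pⁿ∣y²+1 ← √-1-lift {x} p∣x²+1 n = newton-step y pⁿ∣y²+1
    where
    p∤2y : ∀ {y} → + p ∣ℤ y * y + 1ℤ → ¬ + p ∣ℤ + 2 * y
    p∤2y {y} p∣y²+1 p∣2y =
      prime∤1 p-prime (∣-combination 1ℤ -1ℤ p∣y²+1 (∣n⇒∣m*n y (∣2*⇒∣ p∣2y)) (identity y))
      where
      identity : ∀ y → 1ℤ ≡ 1ℤ * (y * y + 1ℤ) + -1ℤ * (y * y)
      identity = solve-∀
    newton-step : ∀ y → + (p ℕ.^ suc n) ∣ℤ y * y + 1ℤ → ∃[ y′ ] + (p ℕ.^ suc (suc n)) ∣ℤ y′ * y′ + 1ℤ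
    newton-step y pⁿ∣y²+1
      with u , p∣2yu-1 ← prime∤⇒inverse p-prime (p∤2y {y} (p^suc∣⇒p∣ n pⁿ∣y²+1)) =
      y - (y * y + 1ℤ) * u , ∣-combination -1ℤ (u * u)
        (pⁿ⁺¹∣*p∣⇒pⁿ⁺²∣ pⁿ∣y²+1 p∣2yu-1)
        (pⁿ⁺¹∣*p∣⇒pⁿ⁺²∣ pⁿ∣y²+1 (p^suc∣⇒p∣ n pⁿ∣y²+1))
        (identity y u)
      where
      modulus : + (p ℕ.^ suc (suc n)) ≡ + (p ℕ.^ suc n) * + p
      modulus = trans (ℤ.pos-* p (p ℕ.^ suc n)) (ℤ.*-comm (+ p) _)
      pⁿ⁺¹∣*p∣⇒pⁿ⁺²∣ : ∀ {a b} → + (p ℕ.^ suc n) ∣ℤ a → + p ∣ℤ b → + (p ℕ.^ suc (suc n)) ∣ℤ a * b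
      pⁿ⁺¹∣*p∣⇒pⁿ⁺²∣ pⁿ⁺¹∣a p∣b = subst (_∣ℤ _) (sym modulus) (*-pres-∣ pⁿ⁺¹∣a p∣b)
      identity : ∀ y u → (y - (y * y + 1ℤ) * u) * (y - (y * y + 1ℤ) * u) + 1ℤ
                         ≡ -1ℤ * ((y * y + 1ℤ) * (+ 2 * y * u - 1ℤ))
                           + u * u * ((y * y + 1ℤ) * (y * y + 1ℤ))
      identity = solve-∀

  scaled-√-1 : ∀ {m n y} → p ∤ m → + (p ℕ.^ n) ∣ℤ y * y + 1ℤ →
               ∃[ c ] (+ m ∣ℤ c × + (p ℕ.^ n) ∣ℤ 4x²+1 c)
  scaled-√-1 {m} {n} {y} p∤m pⁿ∣y²+1
    with v , pⁿ∣2mv-1 ← coprime⇒inverse (prime∤⇒coprime-^ p-prime n (p∤2* p∤m)) =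
    + m * (y * v) , ∣m⇒∣m*n (y * v) ∣-refl ,
    ∣-combination 1ℤ (y * y * (+ (2 ℕ.* m) * v + 1ℤ)) pⁿ∣y²+1 pⁿ∣2mv-1
      (identity (+ m) y v (ℤ.pos-* 2 m))
    where
    polynomial-identity : ∀ M y v → + 4 * (M * (y * v)) * (M * (y * v)) + 1ℤ
                          ≡ 1ℤ * (y * y + 1ℤ) + y * y * (+ 2 * M * v + 1ℤ) * (+ 2 * M * v - 1ℤ)
    polynomial-identity = solve-∀
    identity : ∀ M y v {M₂} → M₂ ≡ + 2 * M →
               + 4 * (M * (y * v)) * (M * (y * v)) + 1ℤ
               ≡ 1ℤ * (y * y + 1ℤ) + y * y * (M₂ * v + 1ℤ) * (M₂ * v - 1ℤ)
    identity M y v refl = polynomial-identity M y v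

-- The functional equation at (c, y, 0)

den-cong : ∀ {n} x x′ y y′ z z′ → n ∣ℤ x - x′ → n ∣ℤ y - y′ → n ∣ℤ z - z′ →
           n ∣ℤ den x y z - den x′ y′ z′
den-cong x x′ y y′ z z′ n∣Δx n∣Δy n∣Δz =
  ∣-combination (+ 4 * (y + z′)) 1ℤ n∣Δx
    (∣-combination (+ 4 * (x′ + z)) (+ 4 * (y′ + x)) n∣Δy n∣Δz refl)
    (identity x x′ y y′ z z′)
  where
  identity : ∀ x x′ y y′ z z′ →
    (+ 4 * (x * y + y * z + z * x) - 1ℤ) - (+ 4 * (x′ * y′ + y′ * z′ + z′ * x′) - 1ℤ)
    ≡ + 4 * (y + z′) * (x - x′) + 1ℤ * (+ 4 * (x′ + z) * (y - y′) + + 4 * (y′ + x) * (z - z′))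
  identity = solve-∀

num-cong : ∀ {n} x x′ y y′ z z′ → n ∣ℤ x - x′ → n ∣ℤ y - y′ → n ∣ℤ z - z′ →
           n ∣ℤ num x y z - num x′ y′ z′
num-cong x x′ y y′ z z′ n∣Δx n∣Δy n∣Δz =
  ∣-combination (+ 4 * y * z - 1ℤ) 1ℤ n∣Δx
    (∣-combination (+ 4 * x′ * z - 1ℤ) (+ 4 * x′ * y′ - 1ℤ) n∣Δy n∣Δz refl)
    (identity x x′ y y′ z z′)
  where
  identity : ∀ x x′ y y′ z z′ →
    (+ 4 * x * y * z - x - y - z) - (+ 4 * x′ * y′ * z′ - x′ - y′ - z′)
    ≡ (+ 4 * y * z - 1ℤ) * (x - x′)
      + 1ℤ * ((+ 4 * x′ * z - 1ℤ) * (y - y′) + (+ 4 * x′ * y′ - 1ℤ) * (z - z′))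
  identity = solve-∀

module Residues (q : ℕ) .{{_ : NonZero q}} where

  -- The reduction [ n ] q of Defs is definitionally fromℤ (+ n).
  fromℤ : ℤ → Fin q
  fromℤ z = fromℕ< (n%ℕd<d z q)

  ⌜fromℤ⌝ : ∀ z → + q ∣ℤ ⌜ fromℤ z ⌝ - z
  ⌜fromℤ⌝ z = subst (λ r → + q ∣ℤ + r - z) (sym (toℕ-fromℕ< (n%ℕd<d z q))) (∣-%ℕ z q)

  fromℤ-cong : ∀ {a b} → + q ∣ℤ a - b → fromℤ a ≡ fromℤ b
  fromℤ-cong {a} {b} q∣a-b = fromℕ<-cong _ _ (∣-<-difference⇒≡ (n%ℕd<d a q) (n%ℕd<d b q)
    (∣-combination 1ℤ 1ℤ (∣-%ℕ a q) (∣-combination -1ℤ 1ℤ (∣-%ℕ b q) q∣a-b refl)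
      (identity (+ (a %ℕ q)) (+ (b %ℕ q)) a b))) _ _
    where
    identity : ∀ r s a b → r - s ≡ 1ℤ * (r - a) + 1ℤ * (-1ℤ * (s - b) + 1ℤ * (a - b))
    identity = solve-∀

module _ {q : ℕ} .{{_ : NonZero q}} {ψ : Fin q → Sign} (fe : SatisfiesFE q ψ) where

  open Residues q

  -- Since q ∣ c(4c² + 1), the value w = c + y(4c² + 1) solves w(4cy - 1) ≡ -c - y (mod q):
  -- the difference is 4y² · c(4c² + 1).
  fe-at-0 : ∀ c y → + q ∣ℤ c * 4x²+1 c → Coprime ∣ den c (+ y) 0ℤ ∣ q →
            (ψ (fromℤ c) *ₛ ψ ([ y ] q)) *ₛ ψ ([ 0 ] q) ≡ ψ (fromℤ (c + + y * 4x²+1 c))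
  fe-at-0 c y q∣cK den⊥q = fe (fromℤ c) ([ y ] q) ([ 0 ] q) (fromℤ w)
    (coprime⇒gcd≡1 {∣ den X Y Z ∣} {q} (coprime-resp-mod (den X Y Z) (den c (+ y) 0ℤ) den≈ den⊥q))
    (∣⇒∣ᵤ congruence)
    where
    w = c + + y * 4x²+1 c
    X = ⌜ fromℤ c ⌝
    Y = ⌜ [ y ] q ⌝
    Z = ⌜ [ 0 ] q ⌝
    den≈ : + q ∣ℤ den X Y Z - den c (+ y) 0ℤ
    den≈ = den-cong X c Y (+ y) Z 0ℤ (⌜fromℤ⌝ c) (⌜fromℤ⌝ (+ y)) (⌜fromℤ⌝ 0ℤ)
    num≈ : + q ∣ℤ num X Y Z - num c (+ y) 0ℤ
    num≈ = num-cong X c Y (+ y) Z 0ℤ (⌜fromℤ⌝ c) (⌜fromℤ⌝ (+ y)) (⌜fromℤ⌝ 0ℤ)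
    identity : ∀ W D N c y →
      W * D - N ≡ D * (W - (c + y * (+ 4 * c * c + 1ℤ)))
                  + 1ℤ * ((c + y * (+ 4 * c * c + 1ℤ)) * (D - (+ 4 * (c * y + y * 0ℤ + 0ℤ * c) - 1ℤ))
                  + 1ℤ * (-1ℤ * (N - (+ 4 * c * y * 0ℤ - c - y - 0ℤ))
                          + + 4 * y * y * (c * (+ 4 * c * c + 1ℤ))))
    identity = solve-∀
    congruence : + q ∣ℤ ⌜ fromℤ w ⌝ * den X Y Z - num X Y Z
    congruence = ∣-combination (den X Y Z) 1ℤ (⌜fromℤ⌝ w)
      (∣-combination w 1ℤ den≈ (∣-combination -1ℤ (+ 4 * + y * + y) num≈ q∣cK refl) refl)
      (identity ⌜ fromℤ w ⌝ (den X Y Z) (num X Y Z) c (+ y))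

  ψ-shift : ∀ c y d → + q ∣ℤ c * 4x²+1 c → + q ∣ℤ + d * 4x²+1 c →
            Coprime ∣ den c (+ y) 0ℤ ∣ q → Coprime ∣ den c (+ (y ℕ.+ d)) 0ℤ ∣ q →
            ψ ([ y ] q) ≡ ψ ([ y ℕ.+ d ] q)
  ψ-shift c y d q∣cK q∣dK den⊥q den′⊥q =
    *-cancelˡ-≡ (ψ (fromℤ c)) _ _ (*-cancelʳ-≡ (ψ ([ 0 ] q)) _ _ (begin
      (ψ (fromℤ c) *ₛ ψ ([ y ] q)) *ₛ ψ ([ 0 ] q)         ≡⟨ fe-at-0 c y q∣cK den⊥q ⟩
      ψ (fromℤ w)                                          ≡⟨ cong ψ (fromℤ-cong {w} shift) ⟩
      ψ (fromℤ w′)                                         ≡⟨ fe-at-0 c (y ℕ.+ d) q∣cK den′⊥q ⟨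
      (ψ (fromℤ c) *ₛ ψ ([ y ℕ.+ d ] q)) *ₛ ψ ([ 0 ] q)   ∎))
    where
    open ≡-Reasoning
    identity : ∀ c y d → c + y * (+ 4 * c * c + 1ℤ) - (c + (y + d) * (+ 4 * c * c + 1ℤ))
                         ≡ -1ℤ * (d * (+ 4 * c * c + 1ℤ))
    identity = solve-∀
    w = c + + y * 4x²+1 c
    w′ = c + + (y ℕ.+ d) * 4x²+1 c
    shift : + q ∣ℤ w - w′
    shift = ∣-multiple -1ℤ q∣dK
      (trans (cong (λ t → w - (c + t * 4x²+1 c)) (ℤ.pos-+ y d)) (identity c (+ y) (+ d)))

-- A proper period

module Period {p q m N : ℕ} .{{_ : NonZero q}} (p-prime : Prime p) (p∤2 : p ∤ 2) (p∤m : p ∤ m)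
              (q≡pᴺm : q ≡ p ℕ.^ suc N ℕ.* m) {ψ : Fin q → Sign} (fe : SatisfiesFE q ψ) where

  open OddPrime p-prime p∤2 using (∣2*⇒∣)

  Admissible : ℤ → Set
  Admissible c = + m ∣ℤ c × + (p ℕ.^ suc N) ∣ℤ 4x²+1 c

  -- (c, y, 0) is in the domain of the functional equation; see regular⇒coprime.
  Regular : ℤ → ℕ → Set
  Regular c y = ¬ + p ∣ℤ den c (+ y) 0ℤ

  p∤m′ : ¬ + p ∣ℤ + m
  p∤m′ = p∤m ∘ ∣⇒∣ᵤ

  admissible-neg : ∀ {c} → Admissible c → Admissible (- c)
  admissible-neg {c} (m∣c , pᴺ∣K) = ∣m⇒∣-m m∣c , subst (_ ∣ℤ_) (identity c) pᴺ∣K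
    where
    identity : ∀ c → + 4 * c * c + 1ℤ ≡ + 4 * - c * - c + 1ℤ
    identity = solve-∀

  p∣4x²+1 : ∀ {c} → Admissible c → + p ∣ℤ 4x²+1 c
  p∣4x²+1 (_ , pᴺ∣K) = p^suc∣⇒p∣ N pᴺ∣K

  q∣*4x²+1 : ∀ {c d} → Admissible c → + m ∣ℤ d → + q ∣ℤ d * 4x²+1 c
  q∣*4x²+1 (_ , pᴺ∣K) m∣d = subst (_∣ℤ _) (sym modulus) (*-pres-∣ m∣d pᴺ∣K)
    where
    modulus : + q ≡ + m * + (p ℕ.^ suc N)
    modulus = trans (cong +_ (trans q≡pᴺm (ℕ.*-comm _ m))) (ℤ.pos-* m _)

  regular⇒coprime : ∀ {c y} → Admissible c → Regular c y → Coprime ∣ den c (+ y) 0ℤ ∣ q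
  regular⇒coprime {c} {y} (m∣c , _) regular = subst (Coprime _) (sym q≡pᴺm)
    (coprime-*ʳ (prime∤⇒coprime-^ p-prime (suc N) (regular ∘ ∣ᵤ⇒∣ {+ p} {den c (+ y) 0ℤ}))
                (∣-suc⇒coprime (den c (+ y) 0ℤ) m∣den+1))
    where
    identity : ∀ c y → + 4 * (c * y + y * 0ℤ + 0ℤ * c) - 1ℤ + 1ℤ ≡ (+ 4 * y) * c
    identity = solve-∀
    m∣den+1 : + m ∣ℤ den c (+ y) 0ℤ + 1ℤ
    m∣den+1 = subst (_ ∣ℤ_) (sym (identity c (+ y))) (∣n⇒∣m*n (+ 4 * + y) m∣c)

  regular-or-regular-neg : ∀ c y → Regular c y ⊎ Regular (- c) y
  regular-or-regular-neg c y with + p ∣? den c (+ y) 0ℤ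
  ... | no p∤den = inj₁ p∤den
  ... | yes p∣den = inj₂ λ p∣den′ →
    prime∤1 p-prime (∣2*⇒∣ (∣-combination -1ℤ -1ℤ p∣den p∣den′ (identity c (+ y))))
    where
    identity : ∀ c y → + 2 * 1ℤ ≡ -1ℤ * (+ 4 * (c * y + y * 0ℤ + 0ℤ * c) - 1ℤ)
                                   + -1ℤ * (+ 4 * (- c * y + y * 0ℤ + 0ℤ * - c) - 1ℤ)
    identity = solve-∀

  non-root⇒regular : ∀ {c z} → Admissible c → ¬ + p ∣ℤ 4x²+1 (+ z) → Regular c z × Regular (- c) z
  non-root⇒regular {c} {z} adm p∤root =
    (λ p∣den  → p∤root (via (∣m⇒∣m*n (den (- c) (+ z) 0ℤ) p∣den))) ,
    (λ p∣den′ → p∤root (via (∣n⇒∣m*n (den c (+ z) 0ℤ) p∣den′)))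
    where
    identity : ∀ c z → + 4 * z * z + 1ℤ ≡ 1ℤ * ((+ 4 * (c * z + z * 0ℤ + 0ℤ * c) - 1ℤ)
                                                 * (+ 4 * (- c * z + z * 0ℤ + 0ℤ * - c) - 1ℤ))
                                           + + 4 * z * z * (+ 4 * c * c + 1ℤ)
    identity = solve-∀
    via : + p ∣ℤ den c (+ z) 0ℤ * den (- c) (+ z) 0ℤ → + p ∣ℤ 4x²+1 (+ z)
    via p∣product = ∣-combination 1ℤ (+ 4 * + z * + z) p∣product (p∣4x²+1 adm) (identity c (+ z))

  roots : ∀ x y → + p ∣ℤ 4x²+1 x → + p ∣ℤ 4x²+1 y → + p ∣ℤ x - y ⊎ + p ∣ℤ x + y
  roots x y p∣x p∣y = prime∣*⇒∣⊎∣ p-prime (x - y) (x + y)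
    (∣2*⇒∣ (∣2*⇒∣ (∣-combination 1ℤ -1ℤ p∣x p∣y (identity x y))))
    where
    identity : ∀ x y → + 2 * (+ 2 * ((x - y) * (x + y)))
                       ≡ 1ℤ * (+ 4 * x * x + 1ℤ) + -1ℤ * (+ 4 * y * y + 1ℤ)
    identity = solve-∀

  no-three-roots : ∀ a → + p ∣ℤ 4x²+1 (a + 1ℤ * + m) → + p ∣ℤ 4x²+1 (a + + 2 * + m) →
                   ¬ + p ∣ℤ 4x²+1 (a + + 3 * + m)
  no-three-roots a p∣z₁ p∣z₂ p∣z₃ = conclude (roots z₁ z₂ p∣z₁ p∣z₂) (roots z₁ z₃ p∣z₁ p∣z₃)
    where
    z₁ = a + 1ℤ * + m
    z₂ = a + + 2 * + m
    z₃ = a + + 3 * + m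
    identity₁ : ∀ a m → m ≡ -1ℤ * (a + 1ℤ * m - (a + + 2 * m))
    identity₁ = solve-∀
    identity₂ : ∀ a m → + 2 * m ≡ -1ℤ * (a + 1ℤ * m - (a + + 3 * m))
    identity₂ = solve-∀
    identity₃ : ∀ a m → m ≡ 1ℤ * (a + 1ℤ * m + (a + + 3 * m)) + -1ℤ * (a + 1ℤ * m + (a + + 2 * m))
    identity₃ = solve-∀
    conclude : + p ∣ℤ z₁ - z₂ ⊎ + p ∣ℤ z₁ + z₂ → + p ∣ℤ z₁ - z₃ ⊎ + p ∣ℤ z₁ + z₃ → ⊥
    conclude (inj₁ p∣z₁-z₂) _ = p∤m′ (∣-multiple -1ℤ p∣z₁-z₂ (identity₁ a (+ m)))
    conclude (inj₂ _) (inj₁ p∣z₁-z₃) = p∤m′ (∣2*⇒∣ (∣-multiple -1ℤ p∣z₁-z₃ (identity₂ a (+ m))))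
    conclude (inj₂ p∣z₁+z₂) (inj₂ p∣z₁+z₃) =
      p∤m′ (∣-combination 1ℤ -1ℤ p∣z₁+z₃ p∣z₁+z₂ (identity₃ a (+ m)))

  non-root-ahead : ∀ n → ∃[ r ] ¬ + p ∣ℤ 4x²+1 (+ (n ℕ.+ suc r ℕ.* m))
  non-root-ahead n = search (+ p ∣? root 0) (+ p ∣? root 1) (+ p ∣? root 2)
    where
    root : ℕ → ℤ
    root r = 4x²+1 (+ (n ℕ.+ suc r ℕ.* m))
    cast : ∀ k → + p ∣ℤ 4x²+1 (+ (n ℕ.+ k ℕ.* m)) → + p ∣ℤ 4x²+1 (+ n + + k * + m)
    cast k = subst (λ t → + p ∣ℤ 4x²+1 t) (pos-+-* n k m)
    search : Dec (+ p ∣ℤ root 0) → Dec (+ p ∣ℤ root 1) → Dec (+ p ∣ℤ root 2) → ∃[ r ] ¬ + p ∣ℤ root r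
    search (no p∤root) _ _ = 0 , p∤root
    search (yes _) (no p∤root) _ = 1 , p∤root
    search (yes _) (yes _) (no p∤root) = 2 , p∤root
    search (yes p∣root₀) (yes p∣root₁) (yes p∣root₂) =
      ⊥-elim (no-three-roots (+ n) (cast 1 p∣root₀) (cast 2 p∣root₁) (cast 3 p∣root₂))

  shift-to-non-root : ∀ {c} → Admissible c → ∀ z → ¬ + p ∣ℤ 4x²+1 (+ z) →
                      ∀ y j → y ℕ.+ j ℕ.* m ≡ z → ψ ([ y ] q) ≡ ψ ([ z ] q)
  shift-to-non-root {c} adm z p∤root y j refl = shift-with (regular-or-regular-neg c y)
    where
    shift : ∀ {s} → Admissible s → Regular s y → Regular s z → ψ ([ y ] q) ≡ ψ ([ z ] q)
    shift {s} adm′ regular regular′ = ψ-shift fe s y (j ℕ.* m) (q∣*4x²+1 adm′ (proj₁ adm′))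
      (q∣*4x²+1 adm′ (∣ᵤ⇒∣ {+ m} {+ (j ℕ.* m)} (ℕ.n∣m*n j)))
      (regular⇒coprime adm′ regular) (regular⇒coprime adm′ regular′)
    shift-with : Regular c y ⊎ Regular (- c) y → ψ ([ y ] q) ≡ ψ ([ z ] q)
    shift-with (inj₁ regular) = shift adm regular (proj₁ (non-root⇒regular adm p∤root))
    shift-with (inj₂ regular) =
      shift (admissible-neg adm) regular (proj₂ (non-root⇒regular adm p∤root))

  period : ∀ {c} → Admissible c → IsPeriod q ψ m
  period adm n = through (non-root-ahead n)
    where
    through : ∃[ r ] ¬ + p ∣ℤ 4x²+1 (+ (n ℕ.+ suc r ℕ.* m)) → ψ ([ n ℕ.+ m ] q) ≡ ψ ([ n ] q)
    through (r , p∤root) =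
      trans (shift-to-non-root adm _ p∤root (n ℕ.+ m) r (ℕ.+-assoc n m (r ℕ.* m)))
            (sym (shift-to-non-root adm _ p∤root n (suc r) refl))

p-part : ∀ {p} .{{_ : ℕ.NonTrivial p}} q .{{_ : NonZero q}} → p ∣ q →
         ∃[ N ] ∃[ m ] (q ≡ p ℕ.^ suc N ℕ.* m × p ∤ m)
p-part {p} q p∣q = go q (<-wellFounded q) p∣q
  where
  go : ∀ q .{{_ : NonZero q}} → Acc ℕ._<_ q → p ∣ q → ∃[ N ] ∃[ m ] (q ≡ p ℕ.^ suc N ℕ.* m × p ∤ m)
  go q (acc rec) p∣q with p ℕ.∣? ℕ.quotient p∣q
  ... | no p∤q′ = 0 , ℕ.quotient p∣q ,
    trans (ℕ.m∣n⇒n≡m*quotient p∣q) (cong (ℕ._* ℕ.quotient p∣q) (sym (ℕ.*-identityʳ p))) , p∤q′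
  ... | yes p∣q′
    with N , m , q′≡pᴺm , p∤m ← go (ℕ.quotient p∣q) {{ℕ.quotient≢0 p∣q}} (rec (ℕ.quotient-< p∣q)) p∣q′ =
    suc N , m ,
    trans (ℕ.m∣n⇒n≡m*quotient p∣q) (trans (cong (p ℕ.*_) q′≡pᴺm) (sym (ℕ.*-assoc p _ m))) , p∤m

prime≡1mod4⇒∤2 : ∀ {p} → Prime p → p % 4 ≡ 1 → p ∤ 2
prime≡1mod4⇒∤2 {p} p-prime p%4≡1 p∣2 with irreducible[2] p∣2 | p%4≡1
... | inj₁ refl | _  = ℕ.nonTrivial⇒≢1 {{prime⇒nonTrivial p-prime}} refl
... | inj₂ refl | ()

factor-bounds : ∀ {q k m} .{{_ : NonZero q}} → 1 ℕ.< k → q ≡ k ℕ.* m → 0 ℕ.< m × m ℕ.< q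
factor-bounds {q} {k} {zero} _ q≡k*0 = ⊥-elim (ℕ.≢-nonZero⁻¹ q (trans q≡k*0 (ℕ.*-zeroʳ k)))
factor-bounds {q} {k} {m@(suc _)} 1<k q≡km =
  ℕ.z<s , subst (m ℕ.<_) (sym (trans q≡km (ℕ.*-comm k m))) (ℕ.m<m*n m k 1<k)

1<p^suc : ∀ {p} .{{_ : ℕ.NonTrivial p}} N → 1 ℕ.< p ℕ.^ suc N
1<p^suc {p} N = ℕ.<-≤-trans (ℕ.nonTrivial⇒n>1 p) (ℕ.m≤m*n p (p ℕ.^ N) {{ℕ.m^n≢0 p N}})
  where instance _ = ℕ.nonTrivial⇒nonZero p

module _ {p q : ℕ} .{{_ : NonZero q}} {ψ : Fin q → Sign}
         (p-prime : Prime p) (p∤2 : p ∤ 2) (fe : SatisfiesFE q ψ) where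

  open OddPrime p-prime p∤2

  √-1⇒¬primitive : p ∣ q → ∃[ x ] + p ∣ℤ x * x + 1ℤ → ¬ Primitive q ψ
  √-1⇒¬primitive p∣q (x , p∣x²+1) ψ-primitive
    with N , m , q≡pᴺm , p∤m ← p-part {{prime⇒nonTrivial p-prime}} q p∣q
    with y , pᴺ∣y²+1 ← √-1-lift {x} p∣x²+1 N
    with c , m∣c , pᴺ∣4c²+1 ← scaled-√-1 {m} {suc N} {y} p∤m pᴺ∣y²+1
    with 0<m , m<q ← factor-bounds (1<p^suc {{prime⇒nonTrivial p-prime}} N) q≡pᴺm
    = ψ-primitive m 0<m m<q (Period.period {N = N} p-prime p∤2 p∤m q≡pᴺm fe (m∣c , pᴺ∣4c²+1))

lemma7p7 : (q : ℕ) → .{{_ : NonZero q}} →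
    (∃[ p ] (Prime p × p ∣ q × p % 4 ≡ 1)) →
    ¬ (∃[ ψ ] (SatisfiesFE q ψ × Primitive q ψ))
lemma7p7 q (p , p-prime , p∣q , p%4≡1) (ψ , fe , ψ-primitive) =
  √-1⇒¬primitive p-prime (prime≡1mod4⇒∤2 p-prime p%4≡1) fe p∣q
    (prime≡1mod4⇒√-1 p-prime p%4≡1) ψ-primitive
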